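{- Let $n\ge1$, let $\sigma$ be a wiggly permutation of $[2n]$ and let $j\in[2n-1]$ be an ascent of $\sigma$, i.e. $\sigma(j)<\sigma(j+1)$. Let $i=\min(j,\sigma^{ -1}(\sigma(j)+1))$ if $\sigma(j)$ is odd and $i=j$ otherwise; let $k=\max(j+1,\sigma^{ -1}(\sigma(j+1)+1))$ if $\sigma(j+1)$ is odd and $k=j+1$ otherwise. Define $\sigma^j=\sigma(1)\cdots\sigma(i-1)\,\sigma(j+1)\cdots\sigma(k)\,\sigma(i)\cdots\sigma(j)\,\sigma(k+1)\cdots\sigma(2n)$. Then $\sigma^j$ is a wiggly permutation with $\mathrm{inv}(\sigma)\cup\{(\sigma(j+1),\sigma(j))\}\subseteq\mathrm{inv}(\sigma^j)$, and $\mathrm{inv}(\sigma^j)\subseteq\mathrm{inv}(\tau)$ for every wiggly permutation $\tau$ with $\mathrm{inv}(\sigma)\cup\{(\sigma(j+1),\sigma(j))\}\subseteq\mathrm{inv}(\tau)$.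
   Context: A wiggly permutation is a permutation of $[2n]$ that avoids the patterns $(2j-1)\cdots i\cdots(2j)$ for $j\in[n]$, $i<2j-1$, and $(2j)\cdots k\cdots(2j-1)$ for $j\in[n]$, $k>2j$ (as subsequences, not necessarily consecutive). The inversion set of a permutation $\sigma$ of $[2n]$ is $\mathrm{inv}(\sigma)=\{(\sigma(p),\sigma(q)) : p<q,\ \sigma(p)>\sigma(q)\}$. -}

module Defs where

open import Data.Nat using (ℕ; zero; suc; _+_; _*_; _∸_; _≤_; _<_; _%_; _⊓_; _⊔_; _≡ᵇ_)
open import Data.List using (List; []; _∷_; map; upTo; take; drop; _++_; length)
open import Data.List.Relation.Binary.Permutation.Propositional using (_↭_)
open import Data.Product using (_×_; ∃; ∃-syntax; _,_)
open import Data.Sum using (_⊎_)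
open import Data.Bool using (if_then_else_)
open import Relation.Binary.PropositionalEquality using (_≡_)
open import Relation.Nullary using (¬_)

-- Permutations of [2n] = {1,…,2n} in one-line notation: the list σ(1) σ(2) … σ(2n).
-- All positions and values are 1-indexed, as in the paper.

range1 : ℕ → List ℕ
range1 m = map suc (upTo m)

IsPerm : ℕ → List ℕ → Set
IsPerm n σ = σ ↭ range1 (2 * n)

-- σ(p), 1-indexed (junk value 0 outside 1..length σ)
at : List ℕ → ℕ → ℕ
at []       _             = 0
at (x ∷ xs) zero          = 0
at (x ∷ xs) (suc zero)    = x
at (x ∷ xs) (suc (suc p)) = at xs (suc p)

-- σ⁻¹(v): 1-indexed position of the first occurrence of v (0 if absent)
pos : List ℕ → ℕ → ℕ
pos []       v = 0
pos (x ∷ xs) v = if x ≡ᵇ v then 1 else (if pos xs v ≡ᵇ 0 then 0 else suc (pos xs v))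

Wiggly : ℕ → List ℕ → Set
Wiggly n σ =
  IsPerm n σ ×
  (∀ p q r j → 1 ≤ p → p < q → q < r → r ≤ 2 * n → 1 ≤ j → j ≤ n →
     ¬ (at σ p ≡ 2 * j ∸ 1 × at σ q < 2 * j ∸ 1 × at σ r ≡ 2 * j)) ×
  (∀ p q r j → 1 ≤ p → p < q → q < r → r ≤ 2 * n → 1 ≤ j → j ≤ n →
     ¬ (at σ p ≡ 2 * j × 2 * j < at σ q × at σ r ≡ 2 * j ∸ 1))

Inv : List ℕ → ℕ → ℕ → Set
Inv σ a b = ∃[ p ] ∃[ q ] (1 ≤ p × p < q × q ≤ length σ × at σ p ≡ a × at σ q ≡ b × b < a)

InvPlus : List ℕ → ℕ → ℕ → ℕ → Set
InvPlus σ j a b = Inv σ a b ⊎ (a ≡ at σ (suc j) × b ≡ at σ j)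

_⊆ᵢ_ : (ℕ → ℕ → Set) → (ℕ → ℕ → Set) → Set
R ⊆ᵢ S = ∀ a b → R a b → S a b

isOdd : ℕ → Data.Bool.Bool
isOdd m = m % 2 ≡ᵇ 1

iIdx : List ℕ → ℕ → ℕ
iIdx σ j = if isOdd (at σ j) then j ⊓ pos σ (suc (at σ j)) else j

kIdx : List ℕ → ℕ → ℕ
kIdx σ j = if isOdd (at σ (suc j)) then suc j ⊔ pos σ (suc (at σ (suc j))) else suc j

slice : List ℕ → ℕ → ℕ → List ℕ
slice σ a b = drop (a ∸ 1) (take b σ)

flipAt : List ℕ → ℕ → List ℕ
flipAt σ j =
  take (i ∸ 1) σ ++ slice σ (suc j) k ++ slice σ i j ++ drop k σ
  where
    i = iIdx σ j
    k = kIdx σ j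

{-# OPTIONS --safe #-}
module Submission where

-- Write a = σ(j) < b = σ(j+1), and A = [i, j], B = [j+1, k] for the two blocks of
-- positions that σʲ exchanges. Avoiding the two patterns forces every value in A to be
-- at most a, except σ(i) = a+1 when i < j, and every value in B to be at least b, with
-- σ(k) = b+1 when k > j+1. So A lies entirely below B, and σʲ has exactly the inversions
-- of σ together with all pairs (σ(v), σ(u)) for u ∈ A, v ∈ B. A forbidden pattern in σʲ
-- would either occur in σ already or contradict the choice of i and k, which ensures
-- that a+1 does not lie left of i and b+1 does not lie right of k. Conversely, if τ is
-- wiggly and contains inv(σ) ∪ {(b, a)}, the same patterns read in τ force every value
-- of B to precede a and a+1 = σ(i), hence every value of A, so inv(σʲ) ⊆ inv(τ).

open import Defs
open import Data.Nat
open import Data.Nat.Properties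
open import Data.Nat.DivMod using (m≡m%n+[m/n]*n; [m+kn]%n≡m%n)
open import Data.Bool using (true; false; T; if_then_else_)
open import Data.List using (List; []; _∷_; upTo; take; drop; _++_; length)
open import Data.List.Properties using (length-map; length-upTo; length-take; length-drop; take-take; take++drop≡id; ++-assoc)
open import Data.List.Membership.Propositional using (_∈_)
open import Data.List.Membership.Propositional.Properties using (∈-map⁻; ∈-map⁺; ∈-upTo⁺; ∈-upTo⁻)
open import Data.List.Relation.Unary.Any using (here; there)
open import Data.List.Relation.Unary.Unique.Propositional using (Unique)
open import Data.List.Relation.Unary.AllPairs using (_∷_)
open import Data.List.Relation.Unary.Unique.Propositional.Properties using (upTo⁺; map⁺; Unique[x∷xs]⇒x∉xs)
open import Data.List.Relation.Binary.Permutation.Propositional using (_↭_; ↭-sym; ↭-trans; ↭-reflexive; ↭⇒↭ₛ)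
open import Data.List.Relation.Binary.Permutation.Propositional.Properties using (∈-resp-↭; ↭-length; ++⁺ˡ; shifts)
import Data.List.Relation.Binary.Permutation.Setoid.Properties as Permutationₛ
open import Data.Product using (∃-syntax; _×_; _,_; proj₁; proj₂)
open import Data.Sum using (_⊎_; inj₁; inj₂; map₁; map₂)
open import Data.Empty using (⊥; ⊥-elim)
open import Function.Base using (_∘_)
open import Data.Nat.Tactic.RingSolver using (solve-∀)
open import Relation.Nullary using (¬_; yes; no; does)
open import Relation.Nullary.Decidable using (dec-true; dec-false)
open import Algebra.Properties.CommutativeSemigroup +-commutativeSemigroup using (xy∙z≈xz∙y)
open import Relation.Binary.Definitions using (tri<; tri≈; tri>)
open import Relation.Binary.PropositionalEquality

at-zero : ∀ xs → at xs 0 ≡ 0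
at-zero []      = refl
at-zero (_ ∷ _) = refl

at-∷ : ∀ x xs {p} → 1 ≤ p → at (x ∷ xs) (suc p) ≡ at xs p
at-∷ x xs (s≤s z≤n) = refl

at-++ˡ : ∀ xs ys {p} → p ≤ length xs → at (xs ++ ys) p ≡ at xs p
at-++ˡ []       ys z≤n = at-zero ys
at-++ˡ (x ∷ xs) ys {zero}          _       = refl
at-++ˡ (x ∷ xs) ys {suc zero}      _       = refl
at-++ˡ (x ∷ xs) ys {suc (suc p)} (s≤s p≤) = at-++ˡ xs ys p≤

at-++ʳ : ∀ xs ys {p} → 1 ≤ p → at (xs ++ ys) (length xs + p) ≡ at ys p
at-++ʳ []       ys _   = refl
at-++ʳ (x ∷ xs) ys {p} 1≤p =
  trans (at-∷ x (xs ++ ys) (≤-trans 1≤p (m≤n+m p (length xs)))) (at-++ʳ xs ys 1≤p)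

at-∈ : ∀ xs {p} → 1 ≤ p → p ≤ length xs → at xs p ∈ xs
at-∈ (x ∷ xs) {suc zero}    _ _        = here refl
at-∈ (x ∷ xs) {suc (suc p)} _ (s≤s p≤) = there (at-∈ xs (s≤s z≤n) p≤)

at-injective : ∀ {xs} → Unique xs → ∀ {p q} → 1 ≤ p → p ≤ length xs → 1 ≤ q → q ≤ length xs →
               at xs p ≡ at xs q → p ≡ q
at-injective {x ∷ xs} u {suc zero}    {suc zero}    _ _ _ _ _ = refl
at-injective {x ∷ xs} u {suc zero}    {suc (suc q)} _ _ _ (s≤s q≤) eq =
  ⊥-elim (Unique[x∷xs]⇒x∉xs u (subst (_∈ xs) (sym eq) (at-∈ xs (s≤s z≤n) q≤)))
at-injective {x ∷ xs} u {suc (suc p)} {suc zero}    _ (s≤s p≤) _ _ eq =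
  ⊥-elim (Unique[x∷xs]⇒x∉xs u (subst (_∈ xs) eq (at-∈ xs (s≤s z≤n) p≤)))
at-injective {x ∷ xs} (_ ∷ u) {suc (suc p)} {suc (suc q)} _ (s≤s p≤) _ (s≤s q≤) eq =
  cong suc (at-injective u (s≤s z≤n) p≤ (s≤s z≤n) q≤ eq)

at-pos : ∀ xs {v} → v ∈ xs → 1 ≤ pos xs v × pos xs v ≤ length xs × at xs (pos xs v) ≡ v
at-pos (x ∷ xs) {v} v∈ with x ≡ᵇ v in x≡ᵇv
... | true = s≤s z≤n , s≤s z≤n , ≡ᵇ⇒≡ x v (subst T (sym x≡ᵇv) _)
... | false with v∈
...   | here v≡x = ⊥-elim (subst T x≡ᵇv (≡⇒≡ᵇ x v (sym v≡x)))
...   | there v∈xs with pos xs v | at-pos xs v∈xs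
...     | suc p | _ , p≤ , at≡v = s≤s z≤n , s≤s p≤ , trans (at-∷ x xs (s≤s z≤n)) at≡v

record IsPermOn (N : ℕ) (f f⁻¹ : ℕ → ℕ) : Set where
  field
    range         : ∀ {p} → 1 ≤ p → p ≤ N → 1 ≤ f p × f p ≤ N
    injective     : ∀ {p q} → 1 ≤ p → p ≤ N → 1 ≤ q → q ≤ N → f p ≡ f q → p ≡ q
    inverse-range : ∀ {v} → 1 ≤ v → v ≤ N → 1 ≤ f⁻¹ v × f⁻¹ v ≤ N
    inverseʳ      : ∀ {v} → 1 ≤ v → v ≤ N → f (f⁻¹ v) ≡ v

  inverseˡ : ∀ {p} → 1 ≤ p → p ≤ N → f⁻¹ (f p) ≡ p
  inverseˡ 1≤p p≤N = injective 1≤f⁻¹fp f⁻¹fp≤N 1≤p p≤N (inverseʳ 1≤fp fp≤N)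
    where
      1≤fp = proj₁ (range 1≤p p≤N)
      fp≤N = proj₂ (range 1≤p p≤N)
      1≤f⁻¹fp = proj₁ (inverse-range 1≤fp fp≤N)
      f⁻¹fp≤N = proj₂ (inverse-range 1≤fp fp≤N)

∈-range1 : ∀ {m v} → v ∈ range1 m → 1 ≤ v × v ≤ m
∈-range1 v∈ with ∈-map⁻ suc v∈
... | _ , w∈ , refl = s≤s z≤n , ∈-upTo⁻ w∈

range1-∈ : ∀ {m v} → 1 ≤ v → v ≤ m → v ∈ range1 m
range1-∈ {v = suc v} _ v≤m = ∈-map⁺ suc (∈-upTo⁺ v≤m)

range1-unique : ∀ m → Unique (range1 m)
range1-unique m = map⁺ suc-injective (upTo⁺ m)

length-perm : ∀ n {σ} → IsPerm n σ → length σ ≡ 2 * n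
length-perm n σ↭ = trans (↭-length σ↭) (trans (length-map suc (upTo (2 * n))) (length-upTo (2 * n)))

isPermOn-at : ∀ n {σ} → IsPerm n σ → IsPermOn (2 * n) (at σ) (pos σ)
isPermOn-at n {σ} σ↭ = record
  { range         = λ 1≤p p≤N → ∈-range1 (∈-resp-↭ σ↭ (at-∈ σ 1≤p (≤-len p≤N)))
  ; injective     = λ 1≤p p≤N 1≤q q≤N → at-injective unique 1≤p (≤-len p≤N) 1≤q (≤-len q≤N)
  ; inverse-range = λ 1≤v v≤N → let (1≤i , i≤len , _) = at-pos σ (∈σ 1≤v v≤N) in 1≤i , len-≤ i≤len
  ; inverseʳ      = λ 1≤v v≤N → proj₂ (proj₂ (at-pos σ (∈σ 1≤v v≤N)))
  }
  where
    ≤-len : ∀ {p} → p ≤ 2 * n → p ≤ length σ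
    ≤-len = subst (_ ≤_) (sym (length-perm n σ↭))
    len-≤ : ∀ {p} → p ≤ length σ → p ≤ 2 * n
    len-≤ = subst (_ ≤_) (length-perm n σ↭)
    unique : Unique σ
    unique = Permutationₛ.Unique-resp-↭ (setoid ℕ) (↭⇒↭ₛ (↭-sym σ↭)) (range1-unique (2 * n))
    ∈σ : ∀ {v} → 1 ≤ v → v ≤ 2 * n → v ∈ σ
    ∈σ 1≤v v≤N = ∈-resp-↭ (↭-sym σ↭) (range1-∈ 1≤v v≤N)

Odd : ℕ → Set
Odd o = ∃[ t ] o ≡ suc (2 * t)

odd⇒¬odd-suc : ∀ {o} → Odd o → ¬ Odd (suc o)
odd⇒¬odd-suc (t , refl) (s , eq) = even≢odd s t (sym (suc-injective eq))

odd⇒1≤ : ∀ {o} → Odd o → 1 ≤ o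
odd⇒1≤ (_ , refl) = s≤s z≤n

odd⇒≢2* : ∀ {o} n → Odd o → o ≢ 2 * n
odd⇒≢2* n (t , refl) eq = even≢odd n t (sym eq)

odd⇒suc≤2* : ∀ {o} n → Odd o → o ≤ 2 * n → suc o ≤ 2 * n
odd⇒suc≤2* n odd o≤ = ≤∧≢⇒< o≤ (odd⇒≢2* n odd)

isOdd≡true⇒Odd : ∀ {o} → isOdd o ≡ true → Odd o
isOdd≡true⇒Odd {o} isOdd-o = o / 2 , trans (m≡m%n+[m/n]*n o 2) (cong₂ _+_ o%2≡1 (*-comm (o / 2) 2))
  where
    o%2≡1 : o % 2 ≡ 1
    o%2≡1 = ≡ᵇ⇒≡ (o % 2) 1 (subst T (sym isOdd-o) _)

Odd⇒isOdd : ∀ {o} → Odd o → isOdd o ≡ true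
Odd⇒isOdd (t , refl) = cong (_≡ᵇ 1) (trans (cong (λ m → suc m % 2) (*-comm 2 t)) ([m+kn]%n≡m%n 1 t 2))

isOdd≡false⇒¬Odd : ∀ {o} → isOdd o ≡ false → ¬ Odd o
isOdd≡false⇒¬Odd isOdd-o odd with trans (sym isOdd-o) (Odd⇒isOdd odd)
... | ()

2*[1+t]∸1≡1+2*t : ∀ t → 2 * suc t ∸ 1 ≡ suc (2 * t)
2*[1+t]∸1≡1+2*t t = +-suc t (t + 0)

2*[1+t]≡2+2*t : ∀ t → 2 * suc t ≡ suc (suc (2 * t))
2*[1+t]≡2+2*t t = cong suc (2*[1+t]∸1≡1+2*t t)

-- The two patterns of Wiggly, with o = 2j−1.
NoDipInRisingPair : ℕ → (ℕ → ℕ) → Set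
NoDipInRisingPair N f = ∀ {o p q r} → Odd o → 1 ≤ p → p < q → q < r → r ≤ N →
  f p ≡ o → f q < o → f r ≡ suc o → ⊥

NoPeakInFallingPair : ℕ → (ℕ → ℕ) → Set
NoPeakInFallingPair N f = ∀ {o p q r} → Odd o → 1 ≤ p → p < q → q < r → r ≤ N →
  f p ≡ suc o → suc o < f q → f r ≡ o → ⊥

wiggly⇒noDip : ∀ {n σ} → Wiggly n σ → NoDipInRisingPair (2 * n) (at σ)
wiggly⇒noDip {n} {σ} (σ↭ , no-dip , _) {q = q} {r} (t , refl) 1≤p p<q q<r r≤N fp fq fr =
  no-dip _ q r (suc t) 1≤p p<q q<r r≤N (s≤s z≤n) 1+t≤n
    ( trans fp (sym (2*[1+t]∸1≡1+2*t t))
    , subst (at σ q <_) (sym (2*[1+t]∸1≡1+2*t t)) fq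
    , trans fr (sym (2*[1+t]≡2+2*t t)) )
  where
    1+t≤n : suc t ≤ n
    1+t≤n = *-cancelˡ-≤ 2 (subst (_≤ 2 * n) (trans fr (sym (2*[1+t]≡2+2*t t)))
              (proj₂ (IsPermOn.range (isPermOn-at n σ↭) (≤-trans 1≤p (<⇒≤ (<-trans p<q q<r))) r≤N)))

wiggly⇒noPeak : ∀ {n σ} → Wiggly n σ → NoPeakInFallingPair (2 * n) (at σ)
wiggly⇒noPeak {n} {σ} (σ↭ , _ , no-peak) {p = p} {q} (t , refl) 1≤p p<q q<r r≤N fp fq fr =
  no-peak p q _ (suc t) 1≤p p<q q<r r≤N (s≤s z≤n) 1+t≤n
    ( trans fp (sym (2*[1+t]≡2+2*t t))
    , subst (_< at σ q) (sym (2*[1+t]≡2+2*t t)) fq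
    , trans fr (sym (2*[1+t]∸1≡1+2*t t)) )
  where
    1+t≤n : suc t ≤ n
    1+t≤n = *-cancelˡ-≤ 2 (subst (_≤ 2 * n) (trans fp (sym (2*[1+t]≡2+2*t t)))
              (proj₂ (IsPermOn.range (isPermOn-at n σ↭) 1≤p (≤-trans (<⇒≤ (<-trans p<q q<r)) r≤N))))

wiggly-intro : ∀ {n σ} → IsPerm n σ → NoDipInRisingPair (2 * n) (at σ) →
               NoPeakInFallingPair (2 * n) (at σ) → Wiggly n σ
wiggly-intro {σ = σ} σ↭ noDip noPeak = σ↭ ,
  (λ { _ _ _ zero _ _ _ _ () _ _
     ; _ q _ (suc t) 1≤p p<q q<r r≤N _ _ (fp , fq , fr) →
         noDip (t , refl) 1≤p p<q q<r r≤N (trans fp (2*[1+t]∸1≡1+2*t t))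
               (subst (at σ q <_) (2*[1+t]∸1≡1+2*t t) fq) (trans fr (2*[1+t]≡2+2*t t)) }) ,
  (λ { _ _ _ zero _ _ _ _ () _ _
     ; _ q _ (suc t) 1≤p p<q q<r r≤N _ _ (fp , fq , fr) →
         noPeak (t , refl) 1≤p p<q q<r r≤N (trans fp (2*[1+t]≡2+2*t t))
                (subst (_< at σ q) (2*[1+t]≡2+2*t t) fq) (trans fr (2*[1+t]∸1≡1+2*t t)) })

noDip-resp-≗ : ∀ {N f g} → f ≗ g → NoDipInRisingPair N f → NoDipInRisingPair N g
noDip-resp-≗ f≗g noDip {p = p} {q} {r} odd 1≤p p<q q<r r≤N gp gq gr =
  noDip odd 1≤p p<q q<r r≤N (trans (f≗g p) gp) (subst (_< _) (sym (f≗g q)) gq) (trans (f≗g r) gr)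

noPeak-resp-≗ : ∀ {N f g} → f ≗ g → NoPeakInFallingPair N f → NoPeakInFallingPair N g
noPeak-resp-≗ f≗g noPeak {p = p} {q} {r} odd 1≤p p<q q<r r≤N gp gq gr =
  noPeak odd 1≤p p<q q<r r≤N (trans (f≗g p) gp) (subst (_ <_) (sym (f≗g q)) gq) (trans (f≗g r) gr)

Inversion : ℕ → (ℕ → ℕ) → ℕ → ℕ → Set
Inversion N f x y = ∃[ p ] ∃[ q ] (1 ≤ p × p < q × q ≤ N × f p ≡ x × f q ≡ y × y < x)

InversionPlus : ℕ → (ℕ → ℕ) → ℕ → ℕ → ℕ → Set
InversionPlus N f j x y = Inversion N f x y ⊎ (x ≡ f (suc j) × y ≡ f j)

inversion-resp-≗ : ∀ {N f g} → f ≗ g → Inversion N f ⊆ᵢ Inversion N g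
inversion-resp-≗ f≗g _ _ (p , q , 1≤p , p<q , q≤N , fp , fq , y<x) =
  p , q , 1≤p , p<q , q≤N , trans (sym (f≗g p)) fp , trans (sym (f≗g q)) fq , y<x

module Precedence {N h h⁻¹} (h-perm : IsPermOn N h h⁻¹) where
  open IsPermOn h-perm

  infix 4 _≺_
  _≺_ : ℕ → ℕ → Set
  x ≺ y = h⁻¹ x < h⁻¹ y

  inversion⇒≺ : ∀ {x y} → Inversion N h x y → x ≺ y
  inversion⇒≺ (p , q , 1≤p , p<q , q≤N , refl , refl , _) =
    subst₂ _<_ (sym (inverseˡ 1≤p (≤-trans (<⇒≤ p<q) q≤N))) (sym (inverseˡ (≤-trans 1≤p (<⇒≤ p<q)) q≤N)) p<q

  ≺⇒inversion : ∀ {x y} → 1 ≤ y → y < x → x ≤ N → x ≺ y → Inversion N h x y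
  ≺⇒inversion 1≤y y<x x≤N x≺y =
    _ , _ , proj₁ (inverse-range 1≤x x≤N) , x≺y , proj₂ (inverse-range 1≤y y≤N) ,
    inverseʳ 1≤x x≤N , inverseʳ 1≤y y≤N , y<x
    where
      1≤x = ≤-trans 1≤y (<⇒≤ y<x)
      y≤N = ≤-trans (<⇒≤ y<x) x≤N

  ≺-total : ∀ {x y} → 1 ≤ x × x ≤ N → 1 ≤ y × y ≤ N → x ≢ y → x ≺ y ⊎ y ≺ x
  ≺-total (1≤x , x≤N) (1≤y , y≤N) x≢y with <-cmp (h⁻¹ _) (h⁻¹ _)
  ... | tri< x≺y _ _ = inj₁ x≺y
  ... | tri> _ _ y≺x = inj₂ y≺x
  ... | tri≈ _ eq _  = ⊥-elim (x≢y (trans (sym (inverseʳ 1≤x x≤N)) (trans (cong h eq) (inverseʳ 1≤y y≤N))))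

  noDip-≺ : NoDipInRisingPair N h → ∀ {o x} → Odd o → suc o ≤ N → 1 ≤ x → x < o →
            o ≺ x → x ≺ suc o → ⊥
  noDip-≺ noDip odd 1+o≤N 1≤x x<o o≺x x≺1+o =
    noDip odd (proj₁ (inverse-range (odd⇒1≤ odd) o≤N)) o≺x x≺1+o (proj₂ (inverse-range (s≤s z≤n) 1+o≤N))
          (inverseʳ (odd⇒1≤ odd) o≤N) (subst (_< _) (sym (inverseʳ 1≤x (<⇒≤ (<-≤-trans x<o o≤N)))) x<o)
          (inverseʳ (s≤s z≤n) 1+o≤N)
    where o≤N = ≤-trans (n≤1+n _) 1+o≤N

  noPeak-≺ : NoPeakInFallingPair N h → ∀ {o x} → Odd o → suc o < x → x ≤ N →
             suc o ≺ x → x ≺ o → ⊥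
  noPeak-≺ noPeak odd 1+o<x x≤N 1+o≺x x≺o =
    noPeak odd (proj₁ (inverse-range (s≤s z≤n) 1+o≤N)) 1+o≺x x≺o (proj₂ (inverse-range (odd⇒1≤ odd) o≤N))
           (inverseʳ (s≤s z≤n) 1+o≤N) (subst (_ <_) (sym (inverseʳ (≤-trans (s≤s z≤n) 1+o<x) x≤N)) 1+o<x)
           (inverseʳ (odd⇒1≤ odd) o≤N)
    where
      1+o≤N = ≤-trans (<⇒≤ 1+o<x) x≤N
      o≤N = ≤-trans (n≤1+n _) 1+o≤N

m<m+suc : ∀ m t → m < m + suc t
m<m+suc m t = m<m+n m (s≤s z≤n)

<⇒≡+suc : ∀ {a p} → a < p → ∃[ t ] p ≡ a + suc t
<⇒≡+suc {a} a<p with m≤n⇒∃[o]m+o≡n a<p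
... | t , eq = t , trans (sym eq) (sym (+-suc a t))

-- With |X| = c, |A| = α and |B| = β, origin p is the position in X ++ A ++ B ++ D of the
-- entry at position p of X ++ B ++ A ++ D.
module BlockSwap (c α β : ℕ) where

  InA InB : ℕ → Set
  InA u = c < u × u ≤ c + α
  InB u = c + α < u × u ≤ c + α + β

  origin : ℕ → ℕ
  origin p = if does (p ≤? c) then p
             else if does (p ≤? c + β) then p + α
             else if does (p ≤? c + α + β) then p ∸ β
             else p

  data Position : ℕ → Set where
    prefix : ∀ {p} → p ≤ c → Position p
    in-B   : ∀ {t} → t < β → Position (c + suc t)
    in-A   : ∀ {t} → t < α → Position (c + β + suc t)
    suffix : ∀ {p} → c + α + β < p → Position p

  c+β+α≡c+α+β : c + β + α ≡ c + α + β
  c+β+α≡c+α+β = xy∙z≈xz∙y c β α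

  private
    c+β≤k : c + β ≤ c + α + β
    c+β≤k = subst (c + β ≤_) c+β+α≡c+α+β (m≤m+n (c + β) α)

    c≤k : c ≤ c + α + β
    c≤k = ≤-trans (m≤m+n c β) c+β≤k

    A≤k : ∀ {t} → t < α → c + β + suc t ≤ c + α + β
    A≤k {t} t<α = subst (c + β + suc t ≤_) c+β+α≡c+α+β (+-monoʳ-≤ (c + β) t<α)

  position : ∀ p → Position p
  position p with p ≤? c | p ≤? c + β | p ≤? c + α + β
  ... | yes p≤c | _         | _         = prefix p≤c
  ... | no p≰c  | yes p≤c+β | _         = in-B-between (≰⇒> p≰c) p≤c+β
    where
      in-B-between : ∀ {p} → c < p → p ≤ c + β → Position p
      in-B-between c<p p≤ with <⇒≡+suc c<p
      ... | t , refl = in-B (+-cancelˡ-≤ c (suc t) β p≤)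
  ... | no _    | no p≰c+β  | yes p≤k   = in-A-between (≰⇒> p≰c+β) (subst (p ≤_) (sym c+β+α≡c+α+β) p≤k)
    where
      in-A-between : ∀ {p} → c + β < p → p ≤ c + β + α → Position p
      in-A-between c+β<p p≤ with <⇒≡+suc c+β<p
      ... | t , refl = in-A (+-cancelˡ-≤ (c + β) (suc t) α p≤)
  ... | no _    | no _      | no p≰k    = suffix (≰⇒> p≰k)

  origin-prefix : ∀ {p} → p ≤ c → origin p ≡ p
  origin-prefix {p} p≤c rewrite dec-true (p ≤? c) p≤c = refl

  origin-B : ∀ {t} → t < β → origin (c + suc t) ≡ c + α + suc t
  origin-B {t} t<β
    rewrite dec-false (c + suc t ≤? c) (<⇒≱ (m<m+suc c t))
          | dec-true (c + suc t ≤? c + β) (+-monoʳ-≤ c t<β) = xy∙z≈xz∙y c (suc t) α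

  origin-A : ∀ {t} → t < α → origin (c + β + suc t) ≡ c + suc t
  origin-A {t} t<α
    rewrite dec-false (c + β + suc t ≤? c) (<⇒≱ (≤-<-trans (m≤m+n c β) (m<m+suc (c + β) t)))
          | dec-false (c + β + suc t ≤? c + β) (<⇒≱ (m<m+suc (c + β) t))
          | dec-true (c + β + suc t ≤? c + α + β) (A≤k t<α) =
    trans (cong (_∸ β) (xy∙z≈xz∙y c β (suc t))) (m+n∸n≡m (c + suc t) β)

  origin-suffix : ∀ {p} → c + α + β < p → origin p ≡ p
  origin-suffix {p} k<p
    rewrite dec-false (p ≤? c) (<⇒≱ (≤-<-trans c≤k k<p))
          | dec-false (p ≤? c + β) (<⇒≱ (≤-<-trans c+β≤k k<p))
          | dec-false (p ≤? c + α + β) (<⇒≱ k<p) = refl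

  data Order (u v : ℕ) : Set where
    swapped : InB u → InA v → Order u v
    kept    : u < v → (InA u → ¬ InB v) → Order u v

  private
    ¬InA-≤ : ∀ {u} → u ≤ c → ¬ InA u
    ¬InA-≤ u≤c (c<u , _) = <⇒≱ c<u u≤c

    ¬InA-> : ∀ {u} → c + α < u → ¬ InA u
    ¬InA-> c+α<u (_ , u≤c+α) = <⇒≱ c+α<u u≤c+α

    ¬InB-≤ : ∀ {v} → v ≤ c + α → ¬ InB v
    ¬InB-≤ v≤c+α (c+α<v , _) = <⇒≱ c+α<v v≤c+α

    ¬InB-> : ∀ {v} → c + α + β < v → ¬ InB v
    ¬InB-> k<v (_ , v≤k) = <⇒≱ k<v v≤k

    suffix-last : ∀ {p q} → q ≤ c + α + β → c + α + β < p → p < q → ⊥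
    suffix-last q≤k k<p p<q = <⇒≱ (<-trans k<p p<q) q≤k

  origin-order : ∀ {p q} → p < q → Order (origin p) (origin q)
  origin-order {p} {q} p<q with position p | position q
  ... | prefix p≤c | prefix q≤c rewrite origin-prefix p≤c | origin-prefix q≤c =
        kept p<q (λ A _ → ¬InA-≤ p≤c A)
  ... | prefix p≤c | in-B {s} s<β rewrite origin-prefix p≤c | origin-B s<β =
        kept (≤-<-trans (≤-trans p≤c (m≤m+n c α)) (m<m+suc (c + α) s)) (λ A _ → ¬InA-≤ p≤c A)
  ... | prefix p≤c | in-A {s} s<α rewrite origin-prefix p≤c | origin-A s<α =
        kept (≤-<-trans p≤c (m<m+suc c s)) (λ A _ → ¬InA-≤ p≤c A)
  ... | prefix p≤c | suffix k<q rewrite origin-prefix p≤c | origin-suffix k<q =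
        kept p<q (λ A _ → ¬InA-≤ p≤c A)
  ... | in-B {t} _ | prefix q≤c = ⊥-elim (<⇒≱ (<-trans (m<m+suc c t) p<q) q≤c)
  ... | in-B {t} t<β | in-B {s} s<β rewrite origin-B t<β | origin-B s<β =
        kept (+-monoʳ-< (c + α) (+-cancelˡ-< c (suc t) (suc s) p<q)) (λ A _ → ¬InA-> (m<m+suc (c + α) t) A)
  ... | in-B {t} t<β | in-A {s} s<α rewrite origin-B t<β | origin-A s<α =
        swapped (m<m+suc (c + α) t , +-monoʳ-≤ (c + α) t<β) (m<m+suc c s , +-monoʳ-≤ c s<α)
  ... | in-B {t} t<β | suffix k<q rewrite origin-B t<β | origin-suffix k<q =
        kept (≤-<-trans (+-monoʳ-≤ (c + α) t<β) k<q) (λ A _ → ¬InA-> (m<m+suc (c + α) t) A)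
  ... | in-A {t} _ | prefix q≤c =
        ⊥-elim (<⇒≱ (<-trans (≤-<-trans (m≤m+n c β) (m<m+suc (c + β) t)) p<q) q≤c)
  ... | in-A {t} _ | in-B s<β = ⊥-elim (<⇒≱ (<-trans (m<m+suc (c + β) t) p<q) (+-monoʳ-≤ c s<β))
  ... | in-A {t} t<α | in-A {s} s<α rewrite origin-A t<α | origin-A s<α =
        kept (+-monoʳ-< c (+-cancelˡ-< (c + β) (suc t) (suc s) p<q)) (λ _ B → ¬InB-≤ (+-monoʳ-≤ c s<α) B)
  ... | in-A {t} t<α | suffix k<q rewrite origin-A t<α | origin-suffix k<q =
        kept (≤-<-trans (≤-trans (+-monoʳ-≤ c t<α) (m≤m+n (c + α) β)) k<q) (λ _ B → ¬InB-> k<q B)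
  ... | suffix k<p | prefix q≤c  = ⊥-elim (suffix-last (≤-trans q≤c c≤k) k<p p<q)
  ... | suffix k<p | in-B s<β    = ⊥-elim (suffix-last (≤-trans (+-monoʳ-≤ c s<β) c+β≤k) k<p p<q)
  ... | suffix k<p | in-A s<α    = ⊥-elim (suffix-last (A≤k s<α) k<p p<q)
  ... | suffix k<p | suffix k<q rewrite origin-suffix k<p | origin-suffix k<q =
        kept p<q (λ _ B → ¬InB-> k<q B)

  origin-range : ∀ {N p} → c + α + β ≤ N → 1 ≤ p → p ≤ N → 1 ≤ origin p × origin p ≤ N
  origin-range {N} {p} k≤N 1≤p p≤N with position p
  ... | prefix p≤c   rewrite origin-prefix p≤c = 1≤p , p≤N
  ... | in-B {t} t<β rewrite origin-B t<β =
        ≤-trans (s≤s z≤n) (m≤n+m (suc t) (c + α)) , ≤-trans (+-monoʳ-≤ (c + α) t<β) k≤N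
  ... | in-A {t} t<α rewrite origin-A t<α =
        ≤-trans (s≤s z≤n) (m≤n+m (suc t) c) , ≤-trans (+-monoʳ-≤ c t<α) (≤-trans (m≤m+n (c + α) β) k≤N)
  ... | suffix k<p   rewrite origin-suffix k<p = 1≤p , p≤N

open BlockSwap using (prefix; in-B; in-A; suffix; swapped; kept)

module _ (c α β : ℕ) where
  private
    module S = BlockSwap c α β
    module S′ = BlockSwap c β α

  origin-inverse : ∀ u → S.origin (S′.origin u) ≡ u
  origin-inverse u with S′.position u
  ... | prefix u≤c rewrite S′.origin-prefix u≤c = S.origin-prefix u≤c
  ... | in-B t<α   rewrite S′.origin-B t<α      = S.origin-A t<α
  ... | in-A t<β   rewrite S′.origin-A t<β      = S.origin-B t<β
  ... | suffix k<u rewrite S′.origin-suffix k<u = S.origin-suffix (subst (_< u) S.c+β+α≡c+α+β k<u)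

at-block : ∀ xs ys zs {p} → 1 ≤ p → p ≤ length ys → at (xs ++ ys ++ zs) (length xs + p) ≡ at ys p
at-block xs ys zs 1≤p p≤ = trans (at-++ʳ xs _ 1≤p) (at-++ˡ ys zs p≤)

1≤m+n : ∀ m {n} → 1 ≤ n → 1 ≤ m + n
1≤m+n m {n} 1≤n = ≤-trans 1≤n (m≤n+m n m)

at-skip₃ : ∀ xs ys zs ws t →
  at (xs ++ ys ++ zs ++ ws) (length xs + (length ys + (length zs + suc t))) ≡ at ws (suc t)
at-skip₃ xs ys zs ws t =
  trans (at-++ʳ xs _ (1≤m+n (length ys) (1≤m+n (length zs) (s≤s z≤n))))
        (trans (at-++ʳ ys _ (1≤m+n (length zs) (s≤s z≤n))) (at-++ʳ zs ws (s≤s z≤n)))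

module _ (X A B D : List ℕ) where
  private
    module S = BlockSwap (length X) (length A) (length B)

  at-swapBlocks : at (X ++ B ++ A ++ D) ≗ at (X ++ A ++ B ++ D) ∘ S.origin
  at-swapBlocks p with S.position p
  ... | prefix p≤c rewrite S.origin-prefix p≤c = trans (at-++ˡ X _ p≤c) (sym (at-++ˡ X _ p≤c))
  ... | in-B {t} t<β rewrite S.origin-B t<β = begin
      at (X ++ B ++ A ++ D) (length X + suc t)                ≡⟨ at-block X B _ (s≤s z≤n) t<β ⟩
      at B (suc t)                                            ≡⟨ at-block A B D (s≤s z≤n) t<β ⟨
      at (A ++ B ++ D) (length A + suc t)                     ≡⟨ at-++ʳ X _ (1≤m+n (length A) (s≤s z≤n)) ⟨
      at (X ++ A ++ B ++ D) (length X + (length A + suc t))   ≡⟨ cong (at (X ++ A ++ B ++ D)) (+-assoc (length X) _ _) ⟨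
      at (X ++ A ++ B ++ D) (length X + length A + suc t)     ∎
    where open ≡-Reasoning
  ... | in-A {t} t<α rewrite S.origin-A t<α = begin
      at (X ++ B ++ A ++ D) (length X + length B + suc t)     ≡⟨ cong (at (X ++ B ++ A ++ D)) (+-assoc (length X) _ _) ⟩
      at (X ++ B ++ A ++ D) (length X + (length B + suc t))   ≡⟨ at-++ʳ X _ (1≤m+n (length B) (s≤s z≤n)) ⟩
      at (B ++ A ++ D) (length B + suc t)                     ≡⟨ at-block B A D (s≤s z≤n) t<α ⟩
      at A (suc t)                                            ≡⟨ at-block X A _ (s≤s z≤n) t<α ⟨
      at (X ++ A ++ B ++ D) (length X + suc t)                ∎
    where open ≡-Reasoning
  ... | suffix k<p with <⇒≡+suc k<p
  ...   | t , refl rewrite S.origin-suffix k<p = begin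
      at (X ++ B ++ A ++ D) (length X + length A + length B + suc t)
        ≡⟨ cong (at (X ++ B ++ A ++ D)) (reorder (length X) (length A) (length B) (suc t)) ⟩
      at (X ++ B ++ A ++ D) (length X + (length B + (length A + suc t)))
        ≡⟨ at-skip₃ X B A D t ⟩
      at D (suc t)
        ≡⟨ at-skip₃ X A B D t ⟨
      at (X ++ A ++ B ++ D) (length X + (length A + (length B + suc t)))
        ≡⟨ cong (at (X ++ A ++ B ++ D)) (reassoc (length X) (length A) (length B) (suc t)) ⟨
      at (X ++ A ++ B ++ D) (length X + length A + length B + suc t)
        ∎
    where
      open ≡-Reasoning
      reorder : ∀ x a b t → x + a + b + t ≡ x + (b + (a + t))
      reorder = solve-∀
      reassoc : ∀ x a b t → x + a + b + t ≡ x + (a + (b + t))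
      reassoc = solve-∀

swapBlocks-↭ : ∀ (X A B D : List ℕ) → X ++ B ++ A ++ D ↭ X ++ A ++ B ++ D
swapBlocks-↭ X A B D = ++⁺ˡ X (shifts B A)

take++drop-take : ∀ {m n} (xs : List ℕ) → m ≤ n → take m xs ++ drop m (take n xs) ≡ take n xs
take++drop-take {m} {n} xs m≤n = begin
  take m xs ++ drop m (take n xs)            ≡⟨ cong (_++ drop m (take n xs)) take-m≡ ⟩
  take m (take n xs) ++ drop m (take n xs)   ≡⟨ take++drop≡id m (take n xs) ⟩
  take n xs                                  ∎
  where
    open ≡-Reasoning
    take-m≡ : take m xs ≡ take m (take n xs)
    take-m≡ = sym (trans (take-take m n xs) (cong (λ l → take l xs) (m≤n⇒m⊓n≡m m≤n)))

length-take-≤ : ∀ {m} (xs : List ℕ) → m ≤ length xs → length (take m xs) ≡ m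
length-take-≤ {m} xs m≤ = trans (length-take m xs) (m≤n⇒m⊓n≡m m≤)

length-drop-take : ∀ m {α} (xs : List ℕ) → m + α ≤ length xs → length (drop m (take (m + α) xs)) ≡ α
length-drop-take m {α} xs m+α≤ =
  trans (length-drop m (take (m + α) xs)) (trans (cong (_∸ m) (length-take-≤ xs m+α≤)) (m+n∸m≡n m α))

module Blocks (σ : List ℕ) (c α β : ℕ) where
  X A B D : List ℕ
  X = take c σ
  A = drop c (take (c + α) σ)
  B = drop (c + α) (take (c + α + β) σ)
  D = drop (c + α + β) σ

  blocks-++ : X ++ A ++ B ++ D ≡ σ
  blocks-++ = begin
    X ++ A ++ B ++ D              ≡⟨ ++-assoc X A (B ++ D) ⟨
    (X ++ A) ++ B ++ D            ≡⟨ cong (_++ B ++ D) (take++drop-take σ (m≤m+n c α)) ⟩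
    take (c + α) σ ++ B ++ D      ≡⟨ ++-assoc (take (c + α) σ) B D ⟨
    (take (c + α) σ ++ B) ++ D    ≡⟨ cong (_++ D) (take++drop-take σ (m≤m+n (c + α) β)) ⟩
    take (c + α + β) σ ++ D       ≡⟨ take++drop≡id (c + α + β) σ ⟩
    σ                             ∎
    where open ≡-Reasoning

  module _ (k≤len : c + α + β ≤ length σ) where
    private
      c+α≤len = ≤-trans (m≤m+n (c + α) β) k≤len

    length-X : length X ≡ c
    length-X = length-take-≤ σ (≤-trans (m≤m+n c α) c+α≤len)

    length-A : length A ≡ α
    length-A = length-drop-take c σ c+α≤len

    length-B : length B ≡ β
    length-B = length-drop-take (c + α) σ k≤len

    swapped-↭ : X ++ B ++ A ++ D ↭ σ
    swapped-↭ = ↭-trans (swapBlocks-↭ X A B D) (↭-reflexive blocks-++)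

    at-swapped : at (X ++ B ++ A ++ D) ≗ at σ ∘ BlockSwap.origin c α β
    at-swapped p = trans (at-swapBlocks X A B D p) (cong₂ at blocks-++ (origin-cong length-X length-A length-B))
      where
        origin-cong : ∀ {c′ α′ β′} → c′ ≡ c → α′ ≡ α → β′ ≡ β →
                      BlockSwap.origin c′ α′ β′ p ≡ BlockSwap.origin c α β p
        origin-cong refl refl refl = refl

record LeftEnd (N : ℕ) (f : ℕ → ℕ) (i j : ℕ) : Set where
  field
    1≤i        : 1 ≤ i
    i≤j        : i ≤ j
    i-partner  : i ≡ j ⊎ (Odd (f j) × f i ≡ suc (f j))
    i-leftmost : Odd (f j) → ∀ {u} → 1 ≤ u → u ≤ N → f u ≡ suc (f j) → i ≤ u

record RightEnd (N : ℕ) (f : ℕ → ℕ) (j k : ℕ) : Set where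
  field
    j<k         : j < k
    k≤N         : k ≤ N
    k-partner   : k ≡ suc j ⊎ (Odd (f (suc j)) × f k ≡ suc (f (suc j)))
    k-rightmost : Odd (f (suc j)) → ∀ {w} → 1 ≤ w → w ≤ N → f w ≡ suc (f (suc j)) → w ≤ k

record FlipWindow (N : ℕ) (f : ℕ → ℕ) (i j k : ℕ) : Set where
  field
    ascent : f j < f (suc j)
    left   : LeftEnd N f i j
    right  : RightEnd N f j k

module Flip {N f f⁻¹} (f-perm : IsPermOn N f f⁻¹)
            (noDip : NoDipInRisingPair N f) (noPeak : NoPeakInFallingPair N f)
            {c α β} (W : FlipWindow N f (suc c) (c + α) (c + α + β)) where
  open IsPermOn f-perm
  open FlipWindow W
  open LeftEnd left
  open RightEnd right
  open BlockSwap c α β using (InA; InB; Order; origin; origin-order; origin-range; c+β+α≡c+α+β)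

  i j k a b : ℕ
  i = suc c
  j = c + α
  k = c + α + β
  a = f j
  b = f (suc j)

  j≤N : j ≤ N
  j≤N = ≤-trans (<⇒≤ j<k) k≤N

  InA⇒bounds : ∀ {u} → InA u → 1 ≤ u × u ≤ N
  InA⇒bounds (i≤u , u≤j) = ≤-trans 1≤i i≤u , ≤-trans u≤j j≤N

  InB⇒bounds : ∀ {v} → InB v → 1 ≤ v × v ≤ N
  InB⇒bounds (j<v , v≤k) = ≤-trans (s≤s z≤n) j<v , ≤-trans v≤k k≤N

  injective-A : ∀ {u v} → InA u → 1 ≤ v → v ≤ N → f u ≡ f v → u ≡ v
  injective-A u∈A = injective (proj₁ (InA⇒bounds u∈A)) (proj₂ (InA⇒bounds u∈A))

  injective-B : ∀ {u v} → InB u → 1 ≤ v → v ≤ N → f u ≡ f v → u ≡ v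
  injective-B u∈B = injective (proj₁ (InB⇒bounds u∈B)) (proj₂ (InB⇒bounds u∈B))

  i∈A : InA i
  i∈A = ≤-refl , i≤j

  j∈A : InA j
  j∈A = i≤j , ≤-refl

  1+j∈B : InB (suc j)
  1+j∈B = ≤-refl , j<k

  k∈B : InB k
  k∈B = j<k , ≤-refl

  A-bound : ∀ {u} → InA u → f u ≤ a ⊎ (u ≡ i × Odd a × f i ≡ suc a)
  A-bound {u} u∈A@(i≤u , u≤j) with i-partner
  ... | inj₁ i≡j = inj₁ (≤-reflexive (cong f (≤-antisym u≤j (subst (_≤ u) i≡j i≤u))))
  ... | inj₂ (odd-a , fi≡1+a) with i ≟ u | u ≟ j
  ...   | yes refl | _        = inj₂ (refl , odd-a , fi≡1+a)
  ...   | no _     | yes refl = inj₁ ≤-refl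
  ...   | no i≢u   | no u≢j   = inj₁ (≤-pred (≤∧≢⇒< fu≤1+a fu≢1+a))
    where
      fu≤1+a : f u ≤ suc a
      fu≤1+a = ≮⇒≥ λ 1+a<fu → noPeak odd-a (s≤s z≤n) (≤∧≢⇒< i≤u i≢u) (≤∧≢⇒< u≤j u≢j) j≤N fi≡1+a 1+a<fu refl
      fu≢1+a : f u ≢ suc a
      fu≢1+a fu≡1+a =
        i≢u (injective-A i∈A (proj₁ (InA⇒bounds u∈A)) (proj₂ (InA⇒bounds u∈A)) (trans fi≡1+a (sym fu≡1+a)))

  data BPosition (v : ℕ) : Set where
    first : v ≡ suc j → BPosition v
    last  : v ≡ k → Odd b → f k ≡ suc b → BPosition v
    inner : suc j < v → v < k → suc b < f v → Odd b → f k ≡ suc b → BPosition v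

  B-position : ∀ {v} → InB v → BPosition v
  B-position {v} v∈B@(j<v , v≤k) with k-partner
  ... | inj₁ k≡1+j = first (≤-antisym (subst (v ≤_) k≡1+j v≤k) j<v)
  ... | inj₂ (odd-b , fk≡1+b) with suc j ≟ v | v ≟ k
  ...   | yes refl | _        = first refl
  ...   | no _     | yes refl = last refl odd-b fk≡1+b
  ...   | no 1+j≢v | no v≢k   = inner 1+j<v v<k (≤∧≢⇒< b<fv 1+b≢fv) odd-b fk≡1+b
    where
      1+j<v = ≤∧≢⇒< j<v 1+j≢v
      v<k = ≤∧≢⇒< v≤k v≢k
      b<fv : b < f v
      b<fv = ≤∧≢⇒< (≮⇒≥ λ fv<b → noDip odd-b (s≤s z≤n) 1+j<v v<k k≤N refl fv<b fk≡1+b)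
                   (λ b≡fv → 1+j≢v (injective-B 1+j∈B (proj₁ (InB⇒bounds v∈B)) (proj₂ (InB⇒bounds v∈B)) b≡fv))
      1+b≢fv : suc b ≢ f v
      1+b≢fv 1+b≡fv = v≢k (injective-B v∈B (proj₁ (InB⇒bounds k∈B)) k≤N (trans (sym 1+b≡fv) (sym fk≡1+b)))

  B-bound : ∀ {v} → InB v → b ≤ f v
  B-bound v∈B with B-position v∈B
  ... | first refl                = ≤-refl
  ... | last refl _ fk≡1+b        = ≤-trans (n≤1+n b) (≤-reflexive (sym fk≡1+b))
  ... | inner _ _ 1+b<fv _ _      = ≤-trans (n≤1+n b) (<⇒≤ 1+b<fv)

  A<B : ∀ {u v} → InA u → InB v → f u < f v
  A<B u∈A v∈B with A-bound u∈A
  ... | inj₁ fu≤a              = <-≤-trans (≤-<-trans fu≤a ascent) (B-bound v∈B)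
  ... | inj₂ (refl , _ , fi≡1+a) = <-≤-trans (≤∧≢⇒< (subst (_≤ b) (sym fi≡1+a) ascent) fi≢b) (B-bound v∈B)
    where
      fi≢b : f i ≢ b
      fi≢b fi≡b = <⇒≱ (s≤s i≤j) (≤-reflexive (sym (injective-A i∈A (s≤s z≤n) (proj₂ (InB⇒bounds 1+j∈B)) fi≡b)))

  odd-in-B-partner-within-k : ∀ {o u w} → Odd o → InB u → k < w → w ≤ N → f u ≡ o → f w ≡ suc o → ⊥
  odd-in-B-partner-within-k odd-o u∈B k<w w≤N fu≡o fw≡1+o with B-position u∈B
  ... | first refl = <⇒≱ k<w (k-rightmost odd-b 1≤w w≤N (trans fw≡1+o (cong suc (sym fu≡o))))
    where
      odd-b = subst Odd (sym fu≡o) odd-o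
      1≤w = ≤-trans (s≤s z≤n) (≤-trans (s≤s (<⇒≤ j<k)) k<w)
  ... | last refl odd-b fk≡1+b = odd⇒¬odd-suc odd-b (subst Odd (trans (sym fu≡o) fk≡1+b) odd-o)
  ... | inner _ u<k 1+b<fu _ fk≡1+b =
        noDip odd-o (proj₁ (InB⇒bounds u∈B)) u<k k<w w≤N fu≡o
              (subst₂ _<_ (sym fk≡1+b) fu≡o 1+b<fu) fw≡1+o

  successor-in-B⇒b : ∀ {u x} → InB u → x ≤ a → f u ≡ suc x → f u ≡ b
  successor-in-B⇒b u∈B x≤a fu≡1+x =
    ≤-antisym (≤-trans (≤-reflexive fu≡1+x) (≤-trans (s≤s x≤a) ascent)) (B-bound u∈B)

  ¬odd-b⇒k≡1+j : ¬ Odd b → k ≡ suc j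
  ¬odd-b⇒k≡1+j ¬odd-b with k-partner
  ... | inj₁ k≡1+j        = k≡1+j
  ... | inj₂ (odd-b , _) = ⊥-elim (¬odd-b odd-b)

  even-in-B-partner-in-A⇒last : ∀ {o u w} → Odd o → InB u → InA w → f w ≡ o → f u ≡ suc o → u ≡ k
  even-in-B-partner-in-A⇒last odd-o u∈B w∈A fw≡o fu≡1+o with A-bound w∈A
  ... | inj₂ (refl , odd-a , fi≡1+a) = ⊥-elim (odd⇒¬odd-suc odd-a (subst Odd (trans (sym fw≡o) fi≡1+a) odd-o))
  ... | inj₁ fw≤a = trans u≡1+j (sym (¬odd-b⇒k≡1+j ¬odd-b))
    where
      fu≡b = successor-in-B⇒b u∈B (subst (_≤ a) fw≡o fw≤a) fu≡1+o
      u≡1+j = injective-B u∈B (s≤s z≤n) (proj₂ (InB⇒bounds 1+j∈B)) fu≡b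
      ¬odd-b : ¬ Odd b
      ¬odd-b odd-b = odd⇒¬odd-suc odd-o (subst Odd (trans (sym fu≡b) fu≡1+o) odd-b)

  even-before-i-partner-not-in-A : ∀ {o u w} → Odd o → 1 ≤ u → u < i → InA w → f w ≡ o → f u ≡ suc o → ⊥
  even-before-i-partner-not-in-A {o} {w = w} odd-o 1≤u u<i w∈A@(i≤w , w≤j) fw≡o fu≡1+o with A-bound w∈A
  ... | inj₂ (refl , odd-a , fi≡1+a) = odd⇒¬odd-suc odd-a (subst Odd (trans (sym fw≡o) fi≡1+a) odd-o)
  ... | inj₁ fw≤a with f w ≟ a
  ...   | yes fw≡a = <⇒≱ u<i (i-leftmost odd-a 1≤u u≤N (trans fu≡1+o (cong suc o≡a)))
    where
      o≡a = trans (sym fw≡o) fw≡a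
      odd-a = subst Odd o≡a odd-o
      u≤N = ≤-trans (<⇒≤ u<i) (≤-trans i≤j j≤N)
  ...   | no fw≢a with i-partner
  ...     | inj₁ i≡j = fw≢a (cong f (≤-antisym w≤j (subst (_≤ w) i≡j i≤w)))
  ...     | inj₂ (_ , fi≡1+a) = noPeak odd-o 1≤u u<i i<w (proj₂ (InA⇒bounds w∈A)) fu≡1+o 1+o<fi fw≡o
    where
      a<fi : a < f i
      a<fi = ≤-reflexive (sym fi≡1+a)
      i<w : i < w
      i<w = ≤∧≢⇒< i≤w λ { refl → <⇒≱ a<fi fw≤a }
      1+o<fi : suc o < f i
      1+o<fi = subst (λ x → suc x < f i) fw≡o (≤-<-trans (≤∧≢⇒< fw≤a fw≢a) a<fi)

  A∩B≡∅ : ∀ {u} → InA u → InB u → ⊥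
  A∩B≡∅ (_ , u≤j) (j<u , _) = <⇒≱ j<u u≤j

  origin-bounds : ∀ {p} → 1 ≤ p → p ≤ N → 1 ≤ origin p × origin p ≤ N
  origin-bounds = origin-range k≤N

  origin-ends : ∀ {p q r} → 1 ≤ p → p < q → q < r → r ≤ N → 1 ≤ origin p × origin r ≤ N
  origin-ends 1≤p p<q q<r r≤N =
    proj₁ (origin-bounds 1≤p (≤-trans (<⇒≤ p<r) r≤N)) , proj₂ (origin-bounds (≤-trans 1≤p (<⇒≤ p<r)) r≤N)
    where p<r = <-trans p<q q<r

  flip-noDip : NoDipInRisingPair N (f ∘ origin)
  flip-noDip {o} {p} {q} {r} odd-o 1≤p p<q q<r r≤N fp fq fr with origin-order p<q | origin-order q<r
  ... | swapped _ q∈A   | swapped q∈B _   = A∩B≡∅ q∈A q∈B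
  ... | kept _ _        | swapped q∈B r∈A = <-asym (A<B r∈A q∈B) (<-trans fq (subst (o <_) (sym fr) (n<1+n o)))
  ... | kept op<oq _    | kept oq<or _    = noDip odd-o (proj₁ ends) op<oq oq<or (proj₂ ends) fp fq fr
    where ends = origin-ends 1≤p p<q q<r r≤N
  ... | swapped p∈B q∈A | kept oq<or A↛B with origin r ≤? j | origin r ≤? k
  ...   | yes r≤j | _       = <-asym (A<B (≤-trans (proj₁ q∈A) (<⇒≤ oq<or) , r≤j) p∈B)
                                     (subst₂ _<_ (sym fp) (sym fr) (n<1+n o))
  ...   | no r≰j  | yes r≤k = A↛B q∈A (≰⇒> r≰j , r≤k)
  ...   | no _    | no r≰k  = odd-in-B-partner-within-k odd-o p∈B (≰⇒> r≰k)
                                (proj₂ (origin-ends 1≤p p<q q<r r≤N)) fp fr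

  flip-noPeak : NoPeakInFallingPair N (f ∘ origin)
  flip-noPeak {o} {p} {q} {r} odd-o 1≤p p<q q<r r≤N fp fq fr with origin-order p<q | origin-order q<r
  ... | swapped p∈B q∈A | _            = <-asym (A<B q∈A p∈B) (subst (_< f (origin q)) (sym fp) fq)
  ... | kept op<oq _    | kept oq<or _ = noPeak odd-o (proj₁ ends) op<oq oq<or (proj₂ ends) fp fq fr
    where ends = origin-ends 1≤p p<q q<r r≤N
  ... | kept op<oq A↛B | swapped q∈B r∈A with origin p ≤? c | origin p ≤? j
  ...   | yes p≤c | _       = even-before-i-partner-not-in-A odd-o
                                (proj₁ (origin-ends 1≤p p<q q<r r≤N)) (s≤s p≤c) r∈A fr fp
  ...   | no p≰c  | yes p≤j = A↛B (≰⇒> p≰c , p≤j) q∈B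
  ...   | no _    | no p≰j  = <⇒≢ (<-≤-trans op<oq (proj₂ q∈B)) (even-in-B-partner-in-A⇒last odd-o p∈B r∈A fr fp)
    where p∈B = ≰⇒> p≰j , ≤-trans (<⇒≤ op<oq) (proj₂ q∈B)

  origin⁻¹ : ℕ → ℕ
  origin⁻¹ = BlockSwap.origin c β α

  origin⁻¹-bounds : ∀ {u} → 1 ≤ u → u ≤ N → 1 ≤ origin⁻¹ u × origin⁻¹ u ≤ N
  origin⁻¹-bounds = BlockSwap.origin-range c β α (subst (_≤ N) (sym c+β+α≡c+α+β) k≤N)

  preimage-order : ∀ {u v} → origin⁻¹ v < origin⁻¹ u → Order v u
  preimage-order {u} {v} q<p = subst₂ Order (origin-inverse c α β v) (origin-inverse c α β u) (origin-order q<p)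

  preimage-inversion : ∀ {u v} → 1 ≤ u → u ≤ N → 1 ≤ v → v ≤ N → u ≢ v → f v < f u →
                       ¬ (origin⁻¹ v < origin⁻¹ u) → Inversion N (f ∘ origin) (f u) (f v)
  preimage-inversion {u} {v} 1≤u u≤N 1≤v v≤N u≢v fv<fu not-reversed with <-cmp (origin⁻¹ u) (origin⁻¹ v)
  ... | tri< p<q _ _ =
        origin⁻¹ u , origin⁻¹ v , proj₁ (origin⁻¹-bounds 1≤u u≤N) , p<q , proj₂ (origin⁻¹-bounds 1≤v v≤N) ,
        cong f (origin-inverse c α β u) , cong f (origin-inverse c α β v) , fv<fu
  ... | tri≈ _ p≡q _ =
        ⊥-elim (u≢v (trans (sym (origin-inverse c α β u)) (trans (cong origin p≡q) (origin-inverse c α β v))))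
  ... | tri> _ _ q<p = ⊥-elim (not-reversed q<p)

  inversionPlus⊆flip : InversionPlus N f j ⊆ᵢ Inversion N (f ∘ origin)
  inversionPlus⊆flip _ _ (inj₁ (u , v , 1≤u , u<v , v≤N , refl , refl , fv<fu)) =
    preimage-inversion 1≤u (≤-trans (<⇒≤ u<v) v≤N) (≤-trans 1≤u (<⇒≤ u<v)) v≤N (<⇒≢ u<v) fv<fu not-reversed
    where
      not-reversed : ¬ (origin⁻¹ v < origin⁻¹ u)
      not-reversed q<p with preimage-order q<p
      ... | swapped v∈B u∈A = <-asym fv<fu (A<B u∈A v∈B)
      ... | kept v<u _      = <-asym u<v v<u
  inversionPlus⊆flip _ _ (inj₂ (refl , refl)) =
    preimage-inversion (s≤s z≤n) (proj₂ (InB⇒bounds 1+j∈B)) (proj₁ (InA⇒bounds j∈A)) j≤N 1+n≢n ascent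
                       not-reversed
    where
      not-reversed : ¬ (origin⁻¹ j < origin⁻¹ (suc j))
      not-reversed q<p with preimage-order q<p
      ... | swapped j∈B _ = A∩B≡∅ j∈A j∈B
      ... | kept _ A↛B    = A↛B j∈A 1+j∈B

  value-bounds : ∀ {p} → 1 ≤ p × p ≤ N → 1 ≤ f p × f p ≤ N
  value-bounds (1≤p , p≤N) = range 1≤p p≤N

  module Minimality {h h⁻¹} (h-perm : IsPermOn N h h⁻¹)
                    (noDip-h : NoDipInRisingPair N h) (noPeak-h : NoPeakInFallingPair N h)
                    (above : InversionPlus N f j ⊆ᵢ Inversion N h) where
    open Precedence h-perm

    inversion-≺ : ∀ {p q} → 1 ≤ p → p < q → q ≤ N → f q < f p → f p ≺ f q
    inversion-≺ 1≤p p<q q≤N fq<fp = inversion⇒≺ (above _ _ (inj₁ (_ , _ , 1≤p , p<q , q≤N , refl , refl , fq<fp)))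

    b≺a : b ≺ a
    b≺a = inversion⇒≺ (above _ _ (inj₂ (refl , refl)))

    partner-of-b≺a : Odd b → f k ≡ suc b → f k ≺ a
    partner-of-b≺a odd-b fk≡1+b
      with ≺-total (value-bounds (InB⇒bounds k∈B)) (value-bounds (InA⇒bounds j∈A)) fk≢a
      where
        fk≢a : f k ≢ a
        fk≢a fk≡a = <⇒≢ (<-trans ascent (n<1+n b)) (trans (sym fk≡a) fk≡1+b)
    ... | inj₁ fk≺a = fk≺a
    ... | inj₂ a≺fk = ⊥-elim (noDip-≺ noDip-h odd-b (subst (_≤ N) fk≡1+b (proj₂ (value-bounds (InB⇒bounds k∈B))))
                               (proj₁ (value-bounds (InA⇒bounds j∈A))) ascent b≺a (subst (a ≺_) fk≡1+b a≺fk))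

    B≺a : ∀ {v} → InB v → f v ≺ a
    B≺a v∈B with B-position v∈B
    ... | first refl                     = b≺a
    ... | last refl odd-b fk≡1+b         = partner-of-b≺a odd-b fk≡1+b
    ... | inner _ v<k 1+b<fv odd-b fk≡1+b =
          <-trans (inversion-≺ (proj₁ (InB⇒bounds v∈B)) v<k k≤N (subst (_< f _) (sym fk≡1+b) 1+b<fv))
                  (partner-of-b≺a odd-b fk≡1+b)

    B≺partner-of-a : ∀ {v} → InB v → Odd a → f i ≡ suc a → f v ≺ f i
    B≺partner-of-a {v} v∈B odd-a fi≡1+a
      with ≺-total (value-bounds (InB⇒bounds v∈B)) (value-bounds (InA⇒bounds i∈A)) (λ eq → <⇒≢ (A<B i∈A v∈B) (sym eq))
    ... | inj₁ fv≺fi = fv≺fi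
    ... | inj₂ fi≺fv = ⊥-elim (noPeak-≺ noPeak-h odd-a (subst (_< f v) fi≡1+a (A<B i∈A v∈B))
                                (proj₂ (value-bounds (InB⇒bounds v∈B))) (subst (_≺ f v) fi≡1+a fi≺fv) (B≺a v∈B))

    B≺A : ∀ {v w} → InB v → InA w → f v ≺ f w
    B≺A {v} {w} v∈B w∈A@(i≤w , w≤j) with A-bound w∈A
    ... | inj₂ (refl , odd-a , fi≡1+a) = B≺partner-of-a v∈B odd-a fi≡1+a
    ... | inj₁ fw≤a with w ≟ j | i-partner
    ...   | yes refl | _        = B≺a v∈B
    ...   | no w≢j   | inj₁ i≡j = ⊥-elim (w≢j (≤-antisym w≤j (subst (_≤ w) i≡j i≤w)))
    ...   | no _     | inj₂ (odd-a , fi≡1+a) =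
          <-trans (B≺partner-of-a v∈B odd-a fi≡1+a) (inversion-≺ 1≤i i<w (proj₂ (InA⇒bounds w∈A)) fw<fi)
      where
        fw<fi : f w < f i
        fw<fi = subst (f w <_) (sym fi≡1+a) (s≤s fw≤a)
        i<w : i < w
        i<w = ≤∧≢⇒< i≤w λ { refl → <-irrefl refl fw<fi }

    flip⊆ : Inversion N (f ∘ origin) ⊆ᵢ Inversion N h
    flip⊆ _ _ (p , q , 1≤p , p<q , q≤N , refl , refl , fq<fp) with origin-order p<q
    ... | swapped p∈B q∈A =
          ≺⇒inversion (proj₁ (value-bounds (InA⇒bounds q∈A))) (A<B q∈A p∈B) (proj₂ (value-bounds (InB⇒bounds p∈B)))
                      (B≺A p∈B q∈A)
    ... | kept op<oq _ = above _ _ (inj₁ (_ , _ , proj₁ (origin-bounds 1≤p (≤-trans (<⇒≤ p<q) q≤N)) , op<oq ,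
                                          proj₂ (origin-bounds (≤-trans 1≤p (<⇒≤ p<q)) q≤N) , refl , refl , fq<fp))

IsLeastWigglyAbove : ℕ → (ℕ → ℕ → Set) → List ℕ → Set
IsLeastWigglyAbove n R ρ =
  Wiggly n ρ × (R ⊆ᵢ Inv ρ) × ((τ : List ℕ) → Wiggly n τ → R ⊆ᵢ Inv τ → Inv ρ ⊆ᵢ Inv τ)

swapWindow : List ℕ → ℕ → ℕ → ℕ → List ℕ
swapWindow σ i j k = take (i ∸ 1) σ ++ slice σ (suc j) k ++ slice σ i j ++ drop k σ

inversion-cast : ∀ {N M f} → N ≡ M → Inversion N f ⊆ᵢ Inversion M f
inversion-cast refl _ _ inv = inv

blockSwap-least : ∀ {n σ c α β} → Wiggly n σ → FlipWindow (2 * n) (at σ) (suc c) (c + α) (c + α + β) →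
                  IsLeastWigglyAbove n (InvPlus σ (c + α)) (swapWindow σ (suc c) (c + α) (c + α + β))
blockSwap-least {n} {σ} {c} {α} {β} wσ@(σ↭ , _) W = wiggly-ρ , above-ρ , least-ρ
  where
    open Flip (isPermOn-at n σ↭) (wiggly⇒noDip wσ) (wiggly⇒noPeak wσ) W
    open Blocks σ c α β
    len-σ = length-perm n σ↭
    k≤len = subst (c + α + β ≤_) (sym len-σ) (RightEnd.k≤N (FlipWindow.right W))
    ρ↭ : IsPerm n (X ++ B ++ A ++ D)
    ρ↭ = ↭-trans (swapped-↭ k≤len) σ↭
    len-ρ = length-perm n ρ↭
    at-ρ = at-swapped k≤len

    wiggly-ρ = wiggly-intro ρ↭ (noDip-resp-≗ (sym ∘ at-ρ) flip-noDip) (noPeak-resp-≗ (sym ∘ at-ρ) flip-noPeak)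

    above-ρ : InvPlus σ (c + α) ⊆ᵢ Inv (X ++ B ++ A ++ D)
    above-ρ x y =
        inversion-cast (sym len-ρ) x y
      ∘ inversion-resp-≗ (sym ∘ at-ρ) x y
      ∘ inversionPlus⊆flip x y
      ∘ map₁ (inversion-cast len-σ x y)

    least-ρ : (τ : List ℕ) → Wiggly n τ → InvPlus σ (c + α) ⊆ᵢ Inv τ → Inv (X ++ B ++ A ++ D) ⊆ᵢ Inv τ
    least-ρ τ wτ@(τ↭ , _) τ-above x y =
        inversion-cast (sym len-τ) x y
      ∘ Minimality.flip⊆ (isPermOn-at n τ↭) (wiggly⇒noDip wτ) (wiggly⇒noPeak wτ) above x y
      ∘ inversion-resp-≗ at-ρ x y
      ∘ inversion-cast len-ρ x y
      where
        len-τ = length-perm n τ↭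
        above : InversionPlus (2 * n) (at σ) (c + α) ⊆ᵢ Inversion (2 * n) (at τ)
        above x y = inversion-cast len-τ x y ∘ τ-above x y ∘ map₁ (inversion-cast (sym len-σ) x y)

swapWindow-least : ∀ {n σ i j k} → Wiggly n σ → FlipWindow (2 * n) (at σ) i j k →
                   IsLeastWigglyAbove n (InvPlus σ j) (swapWindow σ i j k)
swapWindow-least {i = zero} _ W with LeftEnd.1≤i (FlipWindow.left W)
... | ()
swapWindow-least {i = suc c} wσ W
  with m≤n⇒∃[o]m+o≡n (<⇒≤ (LeftEnd.i≤j (FlipWindow.left W)))
     | m≤n⇒∃[o]m+o≡n (<⇒≤ (RightEnd.j<k (FlipWindow.right W)))
... | α , refl | β , refl = blockSwap-least wσ W

module _ (n : ℕ) {σ} (σ↭ : IsPerm n σ) where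
  open IsPermOn (isPermOn-at n σ↭)

  partner : ℕ → ℕ
  partner p = pos σ (suc (at σ p))

  partner-position : ∀ {p} → 1 ≤ p → p ≤ 2 * n → isOdd (at σ p) ≡ true →
    Odd (at σ p) × 1 ≤ partner p × partner p ≤ 2 * n × at σ (partner p) ≡ suc (at σ p)
  partner-position 1≤p p≤N isOdd-fp =
    odd , proj₁ (inverse-range (s≤s z≤n) 1+fp≤N) , proj₂ (inverse-range (s≤s z≤n) 1+fp≤N) ,
    inverseʳ (s≤s z≤n) 1+fp≤N
    where
      odd = isOdd≡true⇒Odd isOdd-fp
      1+fp≤N = odd⇒suc≤2* n odd (proj₂ (range 1≤p p≤N))

  iIdx-leftEnd : ∀ {j} → 1 ≤ j → j ≤ 2 * n → LeftEnd (2 * n) (at σ) (iIdx σ j) j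
  iIdx-leftEnd {j} 1≤j j≤N with isOdd (at σ j) in isOdd-a
  ... | false = record
    { 1≤i        = 1≤j
    ; i≤j        = ≤-refl
    ; i-partner  = inj₁ refl
    ; i-leftmost = λ odd → ⊥-elim (isOdd≡false⇒¬Odd isOdd-a odd)
    }
  ... | true with partner-position 1≤j j≤N isOdd-a
  ...   | odd , 1≤q , q≤N , at-q = record
    { 1≤i        = ⊓-glb 1≤j 1≤q
    ; i≤j        = m⊓n≤m j (partner j)
    ; i-partner  = map₂ (λ i≡q → odd , trans (cong (at σ) i≡q) at-q) (⊓-sel j (partner j))
    ; i-leftmost = λ _ 1≤u u≤N at-u →
        ≤-trans (m⊓n≤n j (partner j)) (≤-reflexive (injective 1≤q q≤N 1≤u u≤N (trans at-q (sym at-u))))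
    }

  kIdx-rightEnd : ∀ {j} → suc j ≤ 2 * n → RightEnd (2 * n) (at σ) j (kIdx σ j)
  kIdx-rightEnd {j} 1+j≤N with isOdd (at σ (suc j)) in isOdd-b
  ... | false = record
    { j<k         = ≤-refl
    ; k≤N         = 1+j≤N
    ; k-partner   = inj₁ refl
    ; k-rightmost = λ odd → ⊥-elim (isOdd≡false⇒¬Odd isOdd-b odd)
    }
  ... | true with partner-position (s≤s z≤n) 1+j≤N isOdd-b
  ...   | odd , 1≤q , q≤N , at-q = record
    { j<k         = m≤m⊔n (suc j) (partner (suc j))
    ; k≤N         = ⊔-lub 1+j≤N q≤N
    ; k-partner   = map₂ (λ k≡q → odd , trans (cong (at σ) k≡q) at-q) (⊔-sel (suc j) (partner (suc j)))
    ; k-rightmost = λ _ 1≤w w≤N at-w →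
        ≤-trans (≤-reflexive (injective 1≤w w≤N 1≤q q≤N (trans at-w (sym at-q)))) (m≤n⊔m (suc j) (partner (suc j)))
    }

lemma2p32 : (n : ℕ) → 1 ≤ n → (σ : List ℕ) → Wiggly n σ →
    (j : ℕ) → 1 ≤ j → j ≤ 2 * n ∸ 1 → at σ j < at σ (suc j) →
    Wiggly n (flipAt σ j)
    × (InvPlus σ j ⊆ᵢ Inv (flipAt σ j))
    × ((τ : List ℕ) → Wiggly n τ → InvPlus σ j ⊆ᵢ Inv τ → Inv (flipAt σ j) ⊆ᵢ Inv τ)
lemma2p32 n 1≤n σ wσ@(σ↭ , _) j 1≤j j≤2n∸1 ascent =
  swapWindow-least wσ record
    { ascent = ascent
    ; left   = iIdx-leftEnd n σ↭ 1≤j (<⇒≤ 1+j≤2n)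
    ; right  = kIdx-rightEnd n σ↭ 1+j≤2n
    }
  where
    1+j≤2n : suc j ≤ 2 * n
    1+j≤2n = m≤pred[n]⇒suc[m]≤n {{>-nonZero (≤-trans 1≤n (m≤m+n n (n + 0)))}} j≤2n∸1
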